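{- Let $G$ be a finite multigraph and $t$ a positive integer such that every partition $P$ of $V(G)$ satisfies $|{\rm cr}(P,G)|\geq t(|P|-1)$, and suppose the edges of $G$ are colored using exactly $\max_{P\colon|P|\geq3}\{|E(P,G)|+t(|P|-2)\}+1$ colors (maximum over partitions $P$ of $V(G)$ with at least $3$ parts). Then for any non-trivial partition $P$ of $V(G)$: (1) if $|P|\geq 3$, then $|c({\rm cr}(P,G))|\geq t(|P|-2)+\eta(P,G)+\xi(P,G)+1$; (2) if $|P|=2$ and $|c(E(G))|>|E(P,G)|$, then $|c({\rm cr}(P,G))|\geq \eta(P,G)+\xi(P,G)+1$.
   Context: A partition $P$ of $V(G)$ is a partition into nonempty parts; $|P|$ is its number of parts; non-trivial means $|P|\ge 2$. ${\rm cr}(P,G)$ is the set of edges whose end vertices lie in different parts of $P$, and $E(P,G)$ is the set of edges whose end vertices lie in the same part. For a set of edges $E$, $c(E)$ is the set of colors appearing on edges of $E$. Define $\eta(P,G):=|E(P,G)|-|c(E(P,G))|$ and $\xi(P,G):=|c(E(P,G))\cap c({\rm cr}(P,G))|$. -}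

module Defs where

open import Data.Nat using (ℕ; zero; suc; _+_; _*_; _∸_; _≤_; _<_; _≥_; _>_)
import Data.Nat.Properties as ℕP
open import Data.Fin using (Fin)
import Data.Fin.Properties as FinP
open import Data.List using (List; length; filter; map; deduplicate)
open import Data.List.Membership.DecPropositional ℕP._≟_ using (_∈?_)
open import Data.Product using (_×_; _,_; ∃; proj₁; proj₂)
open import Relation.Binary.PropositionalEquality using (_≡_)
open import Relation.Nullary using (¬?)
open import Data.Vec.Functional using () renaming (map to vmap)
open import Data.List using (allFin)

-- A finite multigraph: vertices Fin n, edges Fin m, each edge with an
-- (unordered) pair of end vertices given by a function.  Parallel edges
-- (and loops) are allowed.
record Multigraph : Set where
  field
    n    : ℕ
    m    : ℕ
    ends : Fin m → Fin n × Fin n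
open Multigraph public

Colouring : Multigraph → Set
Colouring G = Fin (m G) → ℕ

-- A partition of V(G) into k nonempty parts, given by a surjective map
-- assigning each vertex the index of its part.  |P| = k.
IsPartition : (G : Multigraph) (k : ℕ) → (Fin (n G) → Fin k) → Set
IsPartition G k p = ∀ (j : Fin k) → ∃ λ (v : Fin (n G)) → p v ≡ j

edges : (G : Multigraph) → List (Fin (m G))
edges G = allFin (m G)

inside : (G : Multigraph) {k : ℕ} → (Fin (n G) → Fin k) → List (Fin (m G))
inside G p = filter (λ e → p (proj₁ (ends G e)) FinP.≟ p (proj₂ (ends G e))) (edges G)

crossing : (G : Multigraph) {k : ℕ} → (Fin (n G) → Fin k) → List (Fin (m G))
crossing G p = filter (λ e → ¬? (p (proj₁ (ends G e)) FinP.≟ p (proj₂ (ends G e)))) (edges G)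

colours : (G : Multigraph) → Colouring G → List (Fin (m G)) → List ℕ
colours G c es = deduplicate ℕP._≟_ (map c es)

#colours : (G : Multigraph) → Colouring G → List (Fin (m G)) → ℕ
#colours G c es = length (colours G c es)

#inside : (G : Multigraph) {k : ℕ} → (Fin (n G) → Fin k) → ℕ
#inside G p = length (inside G p)

#crossing : (G : Multigraph) {k : ℕ} → (Fin (n G) → Fin k) → ℕ
#crossing G p = length (crossing G p)

-- η(P,G) = |E(P,G)| - |c(E(P,G))|  (always ≥ 0, so truncated subtraction is exact)
η : (G : Multigraph) → Colouring G → {k : ℕ} → (Fin (n G) → Fin k) → ℕ
η G c p = #inside G p ∸ #colours G c (inside G p)

ξ : (G : Multigraph) → Colouring G → {k : ℕ} → (Fin (n G) → Fin k) → ℕ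
ξ G c p = length (filter (_∈? colours G c (crossing G p)) (colours G c (inside G p)))

IsMaxValue : (G : Multigraph) (t M : ℕ) → Set
IsMaxValue G t M =
  (∃ λ k → ∃ λ (p : Fin (n G) → Fin k) →
     IsPartition G k p × k ≥ 3 × #inside G p + t * (k ∸ 2) ≡ M)
  × (∀ k (p : Fin (n G) → Fin k) → IsPartition G k p → k ≥ 3 →
       #inside G p + t * (k ∸ 2) ≤ M)

-- Every colour of E(G) occurs on E(P,G) or on cr(P,G), so by inclusion–exclusion
-- |c(E(G))| + ξ ≤ |c(E(P,G))| + |c(cr(P,G))|, while |E(P,G)| = |c(E(P,G))| + η.
-- Maximality of M gives |c(E(G))| = M + 1 > |E(P,G)| + t(|P| - 2) when |P| ≥ 3,
-- and both bounds then follow by arithmetic.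
module Submission where

open import Defs
open import Data.Nat using (ℕ; suc; _+_; _*_; _∸_; _≤_; _<_; _≥_; _>_; z≤n; s≤s)
open import Data.Nat.Properties
open import Data.Nat.Tactic.RingSolver using (solve-∀)
open import Data.Fin using (Fin)
import Data.Fin.Properties as FinP
open import Data.Product using (_×_; _,_; ∃; proj₁; proj₂)
open import Data.Sum using (_⊎_; inj₁; inj₂)
open import Data.List using (List; []; _∷_; length; filter; map; _++_)
open import Data.List.Properties using (filter-notAll; length-++; length-map; length-deduplicate)
open import Data.List.Relation.Unary.Any using (here; there)
import Data.List.Relation.Unary.Any as Any
import Data.List.Relation.Unary.All as All
open import Data.List.Relation.Unary.Unique.Propositional using (Unique; _∷_)
open import Data.List.Relation.Unary.Unique.DecPropositional.Properties using (deduplicate-!)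
open import Data.List.Relation.Binary.Subset.Propositional using (_⊆_)
open import Data.List.Membership.Propositional using (_∈_)
open import Data.List.Membership.Propositional.Properties
  using (∈-deduplicate⁺; ∈-deduplicate⁻; ∈-filter⁺; ∈-map⁺; ∈-map⁻; ∈-++⁺ˡ; ∈-++⁺ʳ; ∈-++⁻; ∈-allFin)
open import Function using (_∘_)
open import Relation.Binary.Definitions using (DecidableEquality)
open import Relation.Binary.PropositionalEquality using (_≡_; refl; sym; trans; cong)
open import Relation.Nullary using (¬?; yes; no)
open import Relation.Unary using (Pred; Decidable)
open import Relation.Unary.Properties using (∁?)

length-filter+length-filter-∁ : ∀ {a p} {A : Set a} {P : Pred A p} (P? : Decidable P) (xs : List A) →
  length (filter P? xs) + length (filter (∁? P?) xs) ≡ length xs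
length-filter+length-filter-∁ P? [] = refl
length-filter+length-filter-∁ P? (x ∷ xs) with P? x
... | yes _ = cong suc (length-filter+length-filter-∁ P? xs)
... | no _  = trans (+-suc _ _) (cong suc (length-filter+length-filter-∁ P? xs))

module _ {a} {A : Set a} (_≟_ : DecidableEquality A) where

  open import Data.List.Membership.DecPropositional _≟_ using (_∈?_)

  Unique⇒length-≤ : ∀ {xs ys : List A} → Unique xs → xs ⊆ ys → length xs ≤ length ys
  Unique⇒length-≤ {[]} _ _ = z≤n
  Unique⇒length-≤ {x ∷ xs} {ys} (x∉xs ∷ !xs) x∷xs⊆ys =
    ≤-trans (s≤s (Unique⇒length-≤ !xs xs⊆ys-without-x)) (filter-notAll x≢? ys x∈ys)
    where
    x≢? = λ y → ¬? (x ≟ y)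
    x∈ys = Any.map (λ x≡y x≢y → x≢y x≡y) (x∷xs⊆ys (here refl))
    xs⊆ys-without-x : xs ⊆ filter x≢? ys
    xs⊆ys-without-x z∈xs = ∈-filter⁺ x≢? (x∷xs⊆ys (there z∈xs)) (All.lookup x∉xs z∈xs)

  Unique⇒length+length-∩≤ : ∀ {us} (xs ys : List A) → Unique us → us ⊆ xs ++ ys →
    length us + length (filter (_∈? ys) xs) ≤ length xs + length ys
  Unique⇒length+length-∩≤ {us} xs ys !us us⊆xs++ys = begin
    length us + ∣xs∩ys∣                          ≤⟨ +-monoˡ-≤ ∣xs∩ys∣ (Unique⇒length-≤ !us us⊆xs∖ys++ys) ⟩
    length (xs∖ys ++ ys) + ∣xs∩ys∣               ≡⟨ cong (_+ ∣xs∩ys∣) (length-++ xs∖ys) ⟩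
    length xs∖ys + length ys + ∣xs∩ys∣           ≡⟨ trans (+-comm _ ∣xs∩ys∣) (sym (+-assoc ∣xs∩ys∣ _ _)) ⟩
    (∣xs∩ys∣ + length xs∖ys) + length ys        ≡⟨ cong (_+ length ys) (length-filter+length-filter-∁ (_∈? ys) xs) ⟩
    length xs + length ys                        ∎
    where
    open ≤-Reasoning
    xs∖ys = filter (∁? (_∈? ys)) xs
    ∣xs∩ys∣ = length (filter (_∈? ys) xs)
    us⊆xs∖ys++ys : us ⊆ xs∖ys ++ ys
    us⊆xs∖ys++ys u∈us with ∈-++⁻ xs (us⊆xs++ys u∈us)
    ... | inj₂ u∈ys = ∈-++⁺ʳ xs∖ys u∈ys
    ... | inj₁ u∈xs with _ ∈? ys
    ...   | yes u∈ys = ∈-++⁺ʳ xs∖ys u∈ys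
    ...   | no u∉ys  = ∈-++⁺ˡ (∈-filter⁺ (∁? (_∈? ys)) u∈xs u∉ys)

module _ (G : Multigraph) (c : Colouring G) where

  ∈-colours⁺ : ∀ {es e} → e ∈ es → c e ∈ colours G c es
  ∈-colours⁺ = ∈-deduplicate⁺ _≟_ ∘ ∈-map⁺ c

  ∈-colours⁻ : ∀ {es x} → x ∈ colours G c es → ∃ λ e → e ∈ es × x ≡ c e
  ∈-colours⁻ {es} = ∈-map⁻ c ∘ ∈-deduplicate⁻ _≟_ (map c es)

  colours-unique : ∀ es → Unique (colours G c es)
  colours-unique es = deduplicate-! _≟_ (map c es)

  #colours≤length : ∀ es → #colours G c es ≤ length es
  #colours≤length es = ≤-trans (length-deduplicate _≟_ (map c es)) (≤-reflexive (length-map c es))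

  module _ {k : ℕ} (p : Fin (n G) → Fin k) where

    ∈-inside⊎∈-crossing : ∀ e → e ∈ inside G p ⊎ e ∈ crossing G p
    ∈-inside⊎∈-crossing e with p (proj₁ (ends G e)) FinP.≟ p (proj₂ (ends G e))
    ... | yes same   = inj₁ (∈-filter⁺ _ (∈-allFin e) same)
    ... | no differ  = inj₂ (∈-filter⁺ _ (∈-allFin e) differ)

    colours⊆colours-inside++colours-crossing :
      colours G c (edges G) ⊆ colours G c (inside G p) ++ colours G c (crossing G p)
    colours⊆colours-inside++colours-crossing x∈colours with ∈-colours⁻ x∈colours
    ... | e , _ , refl with ∈-inside⊎∈-crossing e
    ...   | inj₁ e∈inside   = ∈-++⁺ˡ (∈-colours⁺ e∈inside)
    ...   | inj₂ e∈crossing = ∈-++⁺ʳ (colours G c (inside G p)) (∈-colours⁺ e∈crossing)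

    #inside≡#colours+η : #inside G p ≡ #colours G c (inside G p) + η G c p
    #inside≡#colours+η = sym (m+[n∸m]≡n (#colours≤length (inside G p)))

    #colours+ξ≤#colours-inside+#colours-crossing :
      #colours G c (edges G) + ξ G c p ≤ #colours G c (inside G p) + #colours G c (crossing G p)
    #colours+ξ≤#colours-inside+#colours-crossing =
      Unique⇒length+length-∩≤ _≟_ (colours G c (inside G p)) (colours G c (crossing G p))
        (colours-unique (edges G)) colours⊆colours-inside++colours-crossing

    #colours-crossing-bound : ∀ s → #inside G p + s < #colours G c (edges G) →
      s + η G c p + ξ G c p + 1 ≤ #colours G c (crossing G p)
    #colours-crossing-bound s lt = +-cancelˡ-≤ a _ _ (begin
      a + (s + η G c p + ξ G c p + 1)      ≡⟨ rearrange a s (η G c p) (ξ G c p) ⟩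
      suc (a + η G c p + s) + ξ G c p      ≡⟨ cong (λ i → suc (i + s) + ξ G c p) (sym #inside≡#colours+η) ⟩
      suc (#inside G p + s) + ξ G c p      ≤⟨ +-monoˡ-≤ (ξ G c p) lt ⟩
      #colours G c (edges G) + ξ G c p     ≤⟨ #colours+ξ≤#colours-inside+#colours-crossing ⟩
      a + #colours G c (crossing G p)      ∎)
      where
      open ≤-Reasoning
      a = #colours G c (inside G p)
      rearrange : ∀ i s h x → i + (s + h + x + 1) ≡ 1 + (i + h + s) + x
      rearrange = solve-∀

corollary2 : (G : Multigraph) (t : ℕ) → t ≥ 1
    → (∀ k (p : Fin (n G) → Fin k) → IsPartition G k p → #crossing G p ≥ t * (k ∸ 1))
    → (c : Colouring G) (M : ℕ) → IsMaxValue G t M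
    → #colours G c (edges G) ≡ M + 1
    → ∀ k (p : Fin (n G) → Fin k) → IsPartition G k p → k ≥ 2
    → (k ≥ 3 → #colours G c (crossing G p) ≥ t * (k ∸ 2) + η G c p + ξ G c p + 1)
    × (k ≡ 2 → #colours G c (edges G) > #inside G p
    → #colours G c (crossing G p) ≥ η G c p + ξ G c p + 1)
corollary2 G t _ _ c M (_ , M-bounds) #colours≡M+1 k p isP _ =
  (λ k≥3 → #colours-crossing-bound G c p (t * (k ∸ 2))
             (≤-trans (s≤s (M-bounds k p isP k≥3)) (≤-reflexive (trans (+-comm 1 M) (sym #colours≡M+1)))))
  , (λ _ #inside<#colours → #colours-crossing-bound G c p 0
             (≤-trans (≤-reflexive (cong suc (+-identityʳ _))) #inside<#colours))
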